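{- Each of the following ten trees $T$, with lower bounds on list sizes, has the property that for every list assignment $L$ on $V(T)$ satisfying the stated lower bounds $|L(x)|\geq \ell(x)$, there is a map $\phi$ with $\phi(x)\in L(x)$ for all $x$ such that any two distinct vertices at distance at most $2$ in $T$ get different colors. (i) Path $u_1u_2u_3u_4$; $\ell=2,2,3,2$ respectively. (ii) Vertices $u_1,u_2,u_3,u_4,u_5,u_3',u_3''$; edges $u_1u_3,u_3u_4,u_4u_5,u_2u_3,u_3u_3',u_3'u_3''$; $\ell(u_1)=3,\ell(u_2)=2,\ell(u_3)=3,\ell(u_4)=5,\ell(u_5)=2,\ell(u_3')=5,\ell(u_3'')=2$. (iii) The tree of (ii) plus vertices $v_3,v_3'$ and edges $u_3''v_3,u_3''v_3'$; $\ell(u_1)=3,\ell(u_2)=2,\ell(u_3)=4,\ell(u_4)=5,\ell(u_5)=2,\ell(u_3')=6,\ell(u_3'')=4,\ell(v_3)=3,\ell(v_3')=2$. (iv) The tree of (iii) plus vertices $v_5,v_5'$ and edges $u_5v_5,u_5v_5'$; $\ell(u_1)=3,\ell(u_2)=2,\ell(u_3)=4,\ell(u_4)=6,\ell(u_5)=4,\ell(u_3')=6,\ell(u_3'')=4,\ell(v_3)=3,\ell(v_3')=2,\ell(v_5)=3,\ell(v_5')=2$. (v) Path $u_1u_2u_3u_4u_5$ plus path $u_3u_3'u_3''$; $\ell(u_1)=2,\ell(u_2)=3,\ell(u_3)=3,\ell(u_4)=4,\ell(u_5)=2,\ell(u_3')=4,\ell(u_3'')=2$. (vi) The tree of (v)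 plus vertices $v_3,v_3'$ and edges $u_3''v_3,u_3''v_3'$; $\ell(u_1)=2,\ell(u_2)=3,\ell(u_3)=3,\ell(u_4)=4,\ell(u_5)=2,\ell(u_3')=5,\ell(u_3'')=4,\ell(v_3)=3,\ell(v_3')=2$. (vii) The tree of (vi) plus vertices $v_5,v_5'$ and edges $u_5v_5,u_5v_5'$; $\ell(u_1)=2,\ell(u_2)=3,\ell(u_3)=3,\ell(u_4)=5,\ell(u_5)=4,\ell(u_3')=5,\ell(u_3'')=4,\ell(v_3)=3,\ell(v_3')=2,\ell(v_5)=3,\ell(v_5')=2$. (viii) Path $u_0u_1u_2u_3u_4u_5$ plus path $u_3u_3'u_3''$; $\ell(u_0)=2,\ell(u_1)=2,\ell(u_2)=4,\ell(u_3)=3,\ell(u_4)=4,\ell(u_5)=2,\ell(u_3')=4,\ell(u_3'')=2$. (ix) The tree of (viii) plus vertices $v_3,v_3'$ and edges $u_3''v_3,u_3''v_3'$; $\ell(u_0)=2,\ell(u_1)=2,\ell(u_2)=4,\ell(u_3)=3,\ell(u_4)=4,\ell(u_5)=2,\ell(u_3')=5,\ell(u_3'')=4,\ell(v_3)=3,\ell(v_3')=2$. (x) The tree of (ix) plus vertices $v_5,v_5'$ and edges $u_5v_5,u_5v_5'$; $\ell(u_0)=2,\ell(u_1)=2,\ell(u_2)=4,\ell(u_3)=3,\ell(u_4)=5,\ell(u_5)=4,\ell(u_3')=5,\ell(u_3'')=4,\ell(v_3)=3,\ell(v_3')=2,\ell(v_5)=3,\ell(v_5')=2$.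
   Context: Distances are measured in the given tree itself. A list assignment assigns to each vertex $x$ a finite set $L(x)$ of colors. -}

module Defs where

open import Data.Nat using (ℕ; _≤_)
open import Data.Fin using (Fin; #_)
open import Data.Vec using (Vec; []; _∷_; lookup)
open import Data.List using (List; []; _∷_; length)
open import Data.List.Relation.Unary.Unique.Propositional using (Unique)
open import Data.List.Membership.Propositional using (_∈_)
open import Data.Product using (Σ; ∃; _×_; _,_)
open import Data.Sum using (_⊎_)
open import Relation.Binary.PropositionalEquality using (_≡_; _≢_)

Edges : ℕ → Set
Edges n = List (Fin n × Fin n)

Adj : ∀ {n} → Edges n → Fin n → Fin n → Set
Adj E x y = ((x , y) ∈ E) ⊎ ((y , x) ∈ E)

Dist≤2 : ∀ {n} → Edges n → Fin n → Fin n → Set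
Dist≤2 E x y = Adj E x y ⊎ (∃ λ z → Adj E x z × Adj E z y)

-- Colors are natural numbers; a list L(x) is a duplicate-free list (a finite set),
-- so |L(x)| = length (L x).
ListAssignment : ℕ → Set
ListAssignment n = Fin n → List ℕ

Good : ∀ {n} → Edges n → Vec ℕ n → Set
Good {n} E ℓ =
  (L : ListAssignment n) →
  (∀ x → Unique (L x)) →
  (∀ x → lookup ℓ x ≤ length (L x)) →
  Σ (Fin n → ℕ) λ φ →
    (∀ x → φ x ∈ L x) ×
    (∀ x y → x ≢ y → Dist≤2 E x y → φ x ≢ φ y)

-- (i) u1 u2 u3 u4 = 0 1 2 3
E1 : Edges 4
E1 = (# 0 , # 1) ∷ (# 1 , # 2) ∷ (# 2 , # 3) ∷ []
ℓ1 : Vec ℕ 4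
ℓ1 = 2 ∷ 2 ∷ 3 ∷ 2 ∷ []

-- (ii) u1 u2 u3 u4 u5 u3' u3'' = 0 1 2 3 4 5 6
E2 : Edges 7
E2 = (# 0 , # 2) ∷ (# 2 , # 3) ∷ (# 3 , # 4) ∷ (# 1 , # 2) ∷ (# 2 , # 5) ∷ (# 5 , # 6) ∷ []
ℓ2 : Vec ℕ 7
ℓ2 = 3 ∷ 2 ∷ 3 ∷ 5 ∷ 2 ∷ 5 ∷ 2 ∷ []

-- (iii) as (ii), plus v3 v3' = 7 8
E3 : Edges 9
E3 = (# 0 , # 2) ∷ (# 2 , # 3) ∷ (# 3 , # 4) ∷ (# 1 , # 2) ∷ (# 2 , # 5) ∷ (# 5 , # 6)
   ∷ (# 6 , # 7) ∷ (# 6 , # 8) ∷ []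
ℓ3 : Vec ℕ 9
ℓ3 = 3 ∷ 2 ∷ 4 ∷ 5 ∷ 2 ∷ 6 ∷ 4 ∷ 3 ∷ 2 ∷ []

-- (iv) as (iii), plus v5 v5' = 9 10
E4 : Edges 11
E4 = (# 0 , # 2) ∷ (# 2 , # 3) ∷ (# 3 , # 4) ∷ (# 1 , # 2) ∷ (# 2 , # 5) ∷ (# 5 , # 6)
   ∷ (# 6 , # 7) ∷ (# 6 , # 8) ∷ (# 4 , # 9) ∷ (# 4 , # 10) ∷ []
ℓ4 : Vec ℕ 11
ℓ4 = 3 ∷ 2 ∷ 4 ∷ 6 ∷ 4 ∷ 6 ∷ 4 ∷ 3 ∷ 2 ∷ 3 ∷ 2 ∷ []

-- (v) u1 u2 u3 u4 u5 u3' u3'' = 0 1 2 3 4 5 6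
E5 : Edges 7
E5 = (# 0 , # 1) ∷ (# 1 , # 2) ∷ (# 2 , # 3) ∷ (# 3 , # 4) ∷ (# 2 , # 5) ∷ (# 5 , # 6) ∷ []
ℓ5 : Vec ℕ 7
ℓ5 = 2 ∷ 3 ∷ 3 ∷ 4 ∷ 2 ∷ 4 ∷ 2 ∷ []

-- (vi) as (v), plus v3 v3' = 7 8
E6 : Edges 9
E6 = (# 0 , # 1) ∷ (# 1 , # 2) ∷ (# 2 , # 3) ∷ (# 3 , # 4) ∷ (# 2 , # 5) ∷ (# 5 , # 6)
   ∷ (# 6 , # 7) ∷ (# 6 , # 8) ∷ []
ℓ6 : Vec ℕ 9
ℓ6 = 2 ∷ 3 ∷ 3 ∷ 4 ∷ 2 ∷ 5 ∷ 4 ∷ 3 ∷ 2 ∷ []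

-- (vii) as (vi), plus v5 v5' = 9 10
E7 : Edges 11
E7 = (# 0 , # 1) ∷ (# 1 , # 2) ∷ (# 2 , # 3) ∷ (# 3 , # 4) ∷ (# 2 , # 5) ∷ (# 5 , # 6)
   ∷ (# 6 , # 7) ∷ (# 6 , # 8) ∷ (# 4 , # 9) ∷ (# 4 , # 10) ∷ []
ℓ7 : Vec ℕ 11
ℓ7 = 2 ∷ 3 ∷ 3 ∷ 5 ∷ 4 ∷ 5 ∷ 4 ∷ 3 ∷ 2 ∷ 3 ∷ 2 ∷ []

-- (viii) u0 u1 u2 u3 u4 u5 u3' u3'' = 0 1 2 3 4 5 6 7
E8 : Edges 8
E8 = (# 0 , # 1) ∷ (# 1 , # 2) ∷ (# 2 , # 3) ∷ (# 3 , # 4) ∷ (# 4 , # 5) ∷ (# 3 , # 6)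
   ∷ (# 6 , # 7) ∷ []
ℓ8 : Vec ℕ 8
ℓ8 = 2 ∷ 2 ∷ 4 ∷ 3 ∷ 4 ∷ 2 ∷ 4 ∷ 2 ∷ []

-- (ix) as (viii), plus v3 v3' = 8 9
E9 : Edges 10
E9 = (# 0 , # 1) ∷ (# 1 , # 2) ∷ (# 2 , # 3) ∷ (# 3 , # 4) ∷ (# 4 , # 5) ∷ (# 3 , # 6)
   ∷ (# 6 , # 7) ∷ (# 7 , # 8) ∷ (# 7 , # 9) ∷ []
ℓ9 : Vec ℕ 10
ℓ9 = 2 ∷ 2 ∷ 4 ∷ 3 ∷ 4 ∷ 2 ∷ 5 ∷ 4 ∷ 3 ∷ 2 ∷ []

-- (x) as (ix), plus v5 v5' = 10 11
E10 : Edges 12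
E10 = (# 0 , # 1) ∷ (# 1 , # 2) ∷ (# 2 , # 3) ∷ (# 3 , # 4) ∷ (# 4 , # 5) ∷ (# 3 , # 6)
    ∷ (# 6 , # 7) ∷ (# 7 , # 8) ∷ (# 7 , # 9) ∷ (# 5 , # 10) ∷ (# 5 , # 11) ∷ []
ℓ10 : Vec ℕ 12
ℓ10 = 2 ∷ 2 ∷ 4 ∷ 3 ∷ 5 ∷ 4 ∷ 5 ∷ 4 ∷ 3 ∷ 2 ∷ 3 ∷ 2 ∷ []

-- Each tree is settled by a certificate, checked by evaluation, that combines three
-- reductions of list colouring of the square of the tree; throughout one may assume
-- |L(x)| = ℓ(x), truncating longer lists.
-- (1) A vertex with fewer remaining neighbours than ℓ(v) can be coloured last.
-- (2) For conflicting s and t, forbidding the colours of L(t) at s removes the conflict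
--     and lowers ℓ(s) by ℓ(t).
-- (3) For non-conflicting u and v and any w with ℓ(w) < ℓ(u) + ℓ(v): either L(u) and L(v)
--     share a colour, which then goes to both, or L(u) ∪ L(v) has ℓ(u) + ℓ(v) colours, one of
--     which is missing from L(w) and goes to u or to v.  Either way every neighbour of the
--     coloured vertices loses at most one available colour, and w loses none in the second case.
module Submission where

open import Defs
open import Data.Bool using (Bool; true; false; T; not; _∧_; _∨_; if_then_else_)
open import Data.Bool.Properties using (T-≡; T-∧; T-∨)
open import Data.Empty using (⊥-elim)
open import Data.Fin using (Fin; _≟_; #_)
open import Data.Fin.Properties using (all?; any?)
open import Data.List using (List; []; _∷_; [_]; length; filter; map; take; allFin; _++_)
open import Data.List.Properties using (length-map; length-++; length-take; filter-notAll)
open import Data.List.Membership.Propositional using (_∈_; _∉_; find; lose)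
open import Data.List.Membership.Propositional.Properties
  using (∈-filter⁺; ∈-filter⁻; ∈-allFin; ∈-map⁺; ∈-++⁻)
open import Data.List.Relation.Binary.Subset.Propositional using (_⊆_)
import Data.List.Relation.Binary.Sublist.Propositional as Sublist
open import Data.List.Relation.Binary.Sublist.Propositional.Properties using (take-⊆)
import Data.List.Relation.Unary.All as All
open import Data.List.Relation.Unary.Any as Any using (Any; here; there)
open import Data.List.Relation.Unary.AllPairs using (_∷_)
open import Data.List.Relation.Unary.Unique.Propositional using (Unique)
import Data.List.Relation.Unary.Unique.Propositional.Properties as Unique
open import Data.Nat using (ℕ; suc; _+_; _∸_; _≤_; _<_; s≤s⁻¹) renaming (_≟_ to _≟ℕ_)
open import Data.Nat.Properties
  using ( _≤?_; _<?_; ≤-reflexive; ≤-trans; <-≤-trans; ≰⇒>; +-suc; m+n∸n≡m; ∸-monoˡ-≤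
        ; ∸-monoʳ-≤; m≤n⇒m⊓n≡m; module ≤-Reasoning)
open import Data.Product using (∃; ∃-syntax; _×_; _,_; proj₁; proj₂)
open import Data.Product.Properties using (≡-dec)
open import Data.Sum as Sum using (_⊎_; inj₁; inj₂; [_,_]′)
open import Data.Unit using (tt)
open import Data.Vec using (Vec; lookup)
open import Data.Vec.Functional using (updateAt)
open import Data.Vec.Functional.Properties using (updateAt-updates; updateAt-minimal)
open import Function using (_∘_; id)
open import Function.Bundles using (Equivalence)
open import Relation.Binary.Definitions using (DecidableEquality)
open import Relation.Binary.PropositionalEquality
  using (_≡_; _≢_; refl; sym; trans; cong; cong₂; subst)
open import Relation.Nullary using (¬_; Dec; yes; no; ¬?)
open import Relation.Nullary.Decidable
  using (True; False; isYes; T?; toWitness; toWitnessFalse; fromWitness; _⊎-dec_; _×-dec_)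

module ListDifference {A : Set} (_≟ₐ_ : DecidableEquality A) where

  open import Data.List.Membership.DecPropositional _≟ₐ_ public using (_∈?_)

  infixl 5 _∖_
  _∖_ : List A → List A → List A
  xs ∖ ys = filter (λ x → ¬? (x ∈? ys)) xs

  ∈-∖⁻ : ∀ {c} xs ys → c ∈ xs ∖ ys → c ∈ xs × c ∉ ys
  ∈-∖⁻ xs ys = ∈-filter⁻ (λ x → ¬? (x ∈? ys)) {xs = xs}

  Unique-∖ : ∀ {xs} ys → Unique xs → Unique (xs ∖ ys)
  Unique-∖ ys = Unique.filter⁺ (λ x → ¬? (x ∈? ys))

  ∃-fresh : ∀ {xs ys} → Unique xs → length ys < length xs → ∃[ c ] c ∈ xs × c ∉ ys
  ∃-fresh {x ∷ xs} {ys} (x∉xs ∷ xs!) |ys|<|x∷xs| with x ∈? ys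
  ... | no x∉ys = x , here refl , x∉ys
  ... | yes x∈ys =
    let c , c∈xs , c∉ys∖x = ∃-fresh xs! (<-≤-trans |ys∖x|<|ys| (s≤s⁻¹ |ys|<|x∷xs|))
        c∉[x] : c ∉ [ x ]
        c∉[x] = λ { (here c≡x) → All.lookup x∉xs c∈xs (sym c≡x) }
    in c , there c∈xs , λ c∈ys → c∉ys∖x (∈-filter⁺ (λ y → ¬? (y ∈? [ x ])) c∈ys c∉[x])
    where
    |ys∖x|<|ys| : length (ys ∖ [ x ]) < length ys
    |ys∖x|<|ys| = filter-notAll (λ y → ¬? (y ∈? [ x ])) ys
      (Any.map (λ x≡y y∉[x] → y∉[x] (here (sym x≡y))) x∈ys)

  length-⊆ : ∀ {xs ys} → Unique xs → xs ⊆ ys → length xs ≤ length ys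
  length-⊆ {xs} {ys} xs! xs⊆ys with length xs ≤? length ys
  ... | yes |xs|≤|ys| = |xs|≤|ys|
  ... | no  |xs|≰|ys| =
    let c , c∈xs , c∉ys = ∃-fresh xs! (≰⇒> |xs|≰|ys|) in ⊥-elim (c∉ys (xs⊆ys c∈xs))

  length-∖-filter : ∀ xs ys → length xs ≡ length (xs ∖ ys) + length (filter (_∈? ys) xs)
  length-∖-filter []       ys = refl
  length-∖-filter (x ∷ xs) ys with x ∈? ys
  ... | yes _ = trans (cong suc (length-∖-filter xs ys)) (sym (+-suc _ _))
  ... | no  _ = cong suc (length-∖-filter xs ys)

  length-∖ : ∀ {xs} ys → Unique xs → length xs ∸ length ys ≤ length (xs ∖ ys)
  length-∖ {xs} ys xs! = begin
    length xs ∸ length ys                            ≤⟨ ∸-monoʳ-≤ (length xs) |common|≤|ys| ⟩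
    length xs ∸ length common                        ≡⟨ cong (_∸ length common) (length-∖-filter xs ys) ⟩
    length (xs ∖ ys) + length common ∸ length common ≡⟨ m+n∸n≡m (length (xs ∖ ys)) (length common) ⟩
    length (xs ∖ ys)                                 ∎
    where
    open ≤-Reasoning
    common : List A
    common = filter (_∈? ys) xs
    |common|≤|ys| : length common ≤ length ys
    |common|≤|ys| = length-⊆ (Unique.filter⁺ (_∈? ys) xs!) (proj₂ ∘ ∈-filter⁻ (_∈? ys) {xs = xs})

open ListDifference _≟ℕ_

-- Sets and graphs are Boolean functions so that certificates can be checked by evaluation.
VertexSet : ℕ → Set
VertexSet n = Fin n → Bool

Graph : ℕ → Set
Graph n = Fin n → Fin n → Bool

private variable
  n : ℕ
  R : VertexSet n
  G : Graph n
  f : Fin n → ℕ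
  L : ListAssignment n
  c : ℕ
  u v w s t x : Fin n

infixl 6 _─_
infixl 5 _∪_

_─_ : VertexSet n → VertexSet n → VertexSet n
(A ─ B) x = A x ∧ not (B x)

_∪_ : VertexSet n → VertexSet n → VertexSet n
(A ∪ B) x = A x ∨ B x

⁅_⁆ : Fin n → VertexSet n
⁅ v ⁆ x = isYes (x ≟ v)

adjacent : Graph n → Fin n → VertexSet n
adjacent G x y = G x y ∨ G y x

─⁺ : ∀ (A B : VertexSet n) → T (A x) → ¬ T (B x) → T ((A ─ B) x)
─⁺ {x = x} A B Ax ¬Bx with A x | B x
... | true  | false = tt
... | true  | true  = ¬Bx tt
... | false | _     = ⊥-elim Ax

─⁻ : ∀ (A B : VertexSet n) → T ((A ─ B) x) → T (A x)
─⁻ {x = x} A B A─Bx with A x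
... | true = tt

∪⁺ˡ : ∀ (A B : VertexSet n) → T (A x) → T ((A ∪ B) x)
∪⁺ˡ A B Ax = Equivalence.from T-∨ (inj₁ Ax)

∪⁺ʳ : ∀ (A B : VertexSet n) → T (B x) → T ((A ∪ B) x)
∪⁺ʳ {x = x} A B Bx = Equivalence.from (T-∨ {A x}) (inj₂ Bx)

∉⁅⁆ : x ≢ v → ¬ T (⁅ v ⁆ x)
∉⁅⁆ x≢v = x≢v ∘ toWitness

⁅⁆-∈ : ∀ (L : ListAssignment n) → c ∈ L v → T (⁅ v ⁆ x) → c ∈ L x
⁅⁆-∈ {c = c} L c∈Lv x≡v = subst (λ x → c ∈ L x) (sym (toWitness x≡v)) c∈Lv

adjacent⁺ : ∀ (G : Graph n) {x y} → T (G x y) → T (adjacent G x y)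
adjacent⁺ G Gxy = Equivalence.from T-∨ (inj₁ Gxy)

adjacent-sym : ∀ (G : Graph n) {x y} → T (adjacent G x y) → T (adjacent G y x)
adjacent-sym G {x} {y} adj with G x y | G y x
... | true  | true  = tt
... | true  | false = tt
... | false | true  = tt

Independent : Graph n → VertexSet n → Set
Independent G X = ∀ {x y} → T (X x) → T (X y) → x ≢ y → ¬ T (G x y)

⁅⁆-independent : ∀ (G : Graph n) → Independent G ⁅ v ⁆
⁅⁆-independent G x≡v y≡v x≢y _ = x≢y (trans (toWitness x≡v) (sym (toWitness y≡v)))

neighbours : VertexSet n → Graph n → Fin n → List (Fin n)
neighbours R G v = filter (λ w → T? ((R ─ ⁅ v ⁆) w ∧ adjacent G v w)) (allFin _)

degree : VertexSet n → Graph n → Fin n → ℕ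
degree R G v = length (neighbours R G v)

∈-neighbours : ∀ R (G : Graph n) {w} → T ((R ─ ⁅ v ⁆) w) → T (adjacent G v w) →
               w ∈ neighbours R G v
∈-neighbours {v = v} R G {w} Rw vw =
  ∈-filter⁺ (λ w → T? ((R ─ ⁅ v ⁆) w ∧ adjacent G v w)) (∈-allFin w)
    (Equivalence.from (T-∧ {(R ─ ⁅ v ⁆) w}) (Rw , vw))

edge : Fin n → Fin n → Graph n
edge s t x y = isYes ((x ≟ s ×-dec y ≟ t) ⊎-dec (x ≟ t ×-dec y ≟ s))

removeEdge : Fin n → Fin n → Graph n → Graph n
removeEdge s t G x = G x ─ edge s t x

record IsColouring (R : VertexSet n) (G : Graph n) (L : ListAssignment n) (φ : Fin n → ℕ) : Set where
  field
    from-lists : ∀ {x} → T (R x) → φ x ∈ L x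
    proper     : ∀ {x y} → T (R x) → T (R y) → x ≢ y → T (G x y) → φ x ≢ φ y

open IsColouring

Choosable : VertexSet n → Graph n → (Fin n → ℕ) → Set
Choosable {n} R G f = (L : ListAssignment n) → (∀ x → Unique (L x)) →
                      (∀ {x} → T (R x) → f x ≤ length (L x)) → ∃ (IsColouring R G L)

ExactlyChoosable : VertexSet n → Graph n → (Fin n → ℕ) → Set
ExactlyChoosable {n} R G f = (L : ListAssignment n) → (∀ x → Unique (L x)) →
                             (∀ {x} → T (R x) → length (L x) ≡ f x) → ∃ (IsColouring R G L)

colouring-⊆ : ∀ {L′ φ} → (∀ {x} → T (R x) → L′ x ⊆ L x) →
              IsColouring R G L′ φ → IsColouring R G L φ
colouring-⊆ L′⊆L col = record
  { from-lists = λ Rx → L′⊆L Rx (from-lists col Rx)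
  ; proper     = proper col
  }

exactly⇒choosable : ExactlyChoosable R G f → Choosable R G f
exactly⇒choosable {R = R} {f = f} exact L L! f≤|L| =
  let φ , col = exact (λ x → take (f x) (L x)) (λ x → Unique.take⁺ (f x) (L! x)) |take|≡f
  in φ , colouring-⊆ (λ _ → Sublist.lookup (take-⊆ (f _) (L _))) col
  where
  |take|≡f : ∀ {x} → T (R x) → length (take (f x) (L x)) ≡ f x
  |take|≡f {x} Rx = trans (length-take (f x) (L x)) (m≤n⇒m⊓n≡m (f≤|L| Rx))

paint : VertexSet n → ℕ → (Fin n → ℕ) → Fin n → ℕ
paint X c φ x = if X x then c else φ x

≡true⇒T : ∀ {b} → b ≡ true → T b
≡true⇒T = Equivalence.from T-≡

≡false⇒¬T : ∀ {b} → b ≡ false → ¬ T b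
≡false⇒¬T refl ()

paint-colouring : ∀ {φ} (R X : VertexSet n) → Independent G X → (∀ {x} → T (X x) → c ∈ L x) →
  (∀ {x y} → T (X x) → T ((R ─ X) y) → T (adjacent G x y) → c ≢ φ y) →
  IsColouring (R ─ X) G L φ → IsColouring R G L (paint X c φ)
paint-colouring {G = G} {c = c} {L = L} {φ = φ} R X independent c∈L c≢φ col = record
  { from-lists = from-lists′ ; proper = proper′ }
  where
  rest : ∀ {x} → T (R x) → X x ≡ false → T ((R ─ X) x)
  rest Rx Xx = ─⁺ R X Rx (≡false⇒¬T Xx)

  from-lists′ : ∀ {x} → T (R x) → paint X c φ x ∈ L x
  from-lists′ {x} Rx with X x in Xx
  ... | true  = c∈L (≡true⇒T Xx)
  ... | false = from-lists col (rest Rx Xx)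

  proper′ : ∀ {x y} → T (R x) → T (R y) → x ≢ y → T (G x y) → paint X c φ x ≢ paint X c φ y
  proper′ {x} {y} Rx Ry x≢y Gxy with X x in Xx | X y in Xy
  ... | true  | true  = ⊥-elim (independent (≡true⇒T Xx) (≡true⇒T Xy) x≢y Gxy)
  ... | true  | false = c≢φ (≡true⇒T Xx) (rest Ry Xy) (adjacent⁺ G Gxy)
  ... | false | true  = c≢φ (≡true⇒T Xy) (rest Rx Xx) (adjacent-sym G (adjacent⁺ G Gxy)) ∘ sym
  ... | false | false = proper col (rest Rx Xx) (rest Ry Xy) x≢y Gxy

purge : VertexSet n → ℕ → ListAssignment n → ListAssignment n
purge N c L y = if N y then L y ∖ [ c ] else L y

lower : VertexSet n → (Fin n → ℕ) → Fin n → ℕ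
lower N f y = if N y then f y ∸ 1 else f y

purge-⊆ : ∀ (N : VertexSet n) c L {y} → purge N c L y ⊆ L y
purge-⊆ N c L {y} with N y
... | true  = proj₁ ∘ ∈-∖⁻ (L y) [ c ]
... | false = id

purge-Unique : ∀ (N : VertexSet n) c L {y} → Unique (L y) → Unique (purge N c L y)
purge-Unique N c L {y} Ly! with N y
... | true  = Unique-∖ [ c ] Ly!
... | false = Ly!

∉-purge : ∀ (N : VertexSet n) c L {y} → T (N y) → c ∉ purge N c L y
∉-purge N c L {y} Ny with N y
... | true = λ c∈ → proj₂ (∈-∖⁻ (L y) [ c ] c∈) (here refl)

lower≤purge : ∀ (N : VertexSet n) c L f {y} → Unique (L y) → f y ≤ length (L y) →
              lower N f y ≤ length (purge N c L y)
lower≤purge N c L f {y} Ly! f≤|L| with N y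
... | true  = ≤-trans (∸-monoˡ-≤ 1 f≤|L|) (length-∖ [ c ] Ly!)
... | false = f≤|L|

colour-by-painting : ∀ (R X N : VertexSet n) → Independent G X → (∀ {x} → T (X x) → c ∈ L x) →
  (∀ {x y} → T (X x) → T ((R ─ X) y) → T (adjacent G x y) → T (N y) ⊎ c ∉ L y) →
  (∀ x → Unique (L x)) → (∀ {x} → T (R x) → f x ≤ length (L x)) →
  Choosable (R ─ X) G (lower N f) → ∃ (IsColouring R G L)
colour-by-painting {G = G} {c = c} {L = L} {f = f} R X N independent c∈L spared L! f≤|L| rest =
  extend (rest (purge N c L) (λ y → purge-Unique N c L (L! y))
                             (λ {y} Ry → lower≤purge N c L f (L! y) (f≤|L| (─⁻ R X Ry))))
  where
  extend : ∃ (IsColouring (R ─ X) G (purge N c L)) → ∃ (IsColouring R G L)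
  extend (φ , col) =
    paint X c φ , paint-colouring R X independent c∈L c≢φ (colouring-⊆ (λ _ → purge-⊆ N c L) col)
    where
    c≢φ : ∀ {x y} → T (X x) → T ((R ─ X) y) → T (adjacent G x y) → c ≢ φ y
    c≢φ {y = y} Xx Ry adj c≡φy = [ ∉-purge N c L , (λ c∉Ly → c∉Ly ∘ purge-⊆ N c L) ]′
      (spared Xx Ry adj) (subst (_∈ purge N c L y) (sym c≡φy) (from-lists col Ry))

-- The reduction rules

choosable-∅ : (∀ x → ¬ T (R x)) → Choosable R G f
choosable-∅ R-empty _ _ _ = (λ _ → 0) , record
  { from-lists = λ {x} Rx → ⊥-elim (R-empty x Rx)
  ; proper     = λ {x} Rx → ⊥-elim (R-empty x Rx)
  }

choosable-greedy : ∀ (R : VertexSet n) → T (R v) → degree R G v < f v →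
                   Choosable (R ─ ⁅ v ⁆) G f → Choosable R G f
choosable-greedy {v = v} {G = G} {f = f} R Rv deg<f rest L L! f≤|L| =
  extend (rest L L! (f≤|L| ∘ ─⁻ R ⁅ v ⁆))
  where
  extend : ∃ (IsColouring (R ─ ⁅ v ⁆) G L) → ∃ (IsColouring R G L)
  extend (φ , col) = colour-v (∃-fresh (L! v) |used|<|Lv|)
    where
    used : List ℕ
    used = map φ (neighbours R G v)

    |used|<|Lv| : length used < length (L v)
    |used|<|Lv| = begin-strict
      length used     ≡⟨ length-map φ (neighbours R G v) ⟩
      degree R G v    <⟨ deg<f ⟩
      f v             ≤⟨ f≤|L| Rv ⟩
      length (L v)    ∎
      where open ≤-Reasoning

    colour-v : ∃[ c ] c ∈ L v × c ∉ used → ∃ (IsColouring R G L)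
    colour-v (c , c∈Lv , c∉used) =
      paint ⁅ v ⁆ c φ , paint-colouring R ⁅ v ⁆ (⁅⁆-independent G) (⁅⁆-∈ L c∈Lv) c≢φ col
      where
      c≢φ : ∀ {x y} → T (⁅ v ⁆ x) → T ((R ─ ⁅ v ⁆) y) → T (adjacent G x y) → c ≢ φ y
      c≢φ x≡v Ry adj c≡φy with toWitness x≡v
      ... | refl = c∉used (subst (_∈ used) (sym c≡φy) (∈-map⁺ φ (∈-neighbours R G Ry adj)))

choosable-split : ∀ (R : VertexSet n) → s ≢ t → T (R t) →
  Choosable R (removeEdge s t G) (updateAt f s (_∸ f t)) → Choosable R G f
choosable-split {n = n} {s = s} {t = t} {G = G} {f = f} R s≢t Rt rest = exactly⇒choosable colour
  where
  colour : ExactlyChoosable R G f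
  colour L L! |L|≡f = separate (rest L′ L′! f′≤|L′|)
    where
    L′ : ListAssignment n
    L′ = updateAt L s (_∖ L t)

    L′! : ∀ x → Unique (L′ x)
    L′! x with x ≟ s
    ... | yes refl rewrite updateAt-updates s {_∖ L t} L = Unique-∖ (L t) (L! s)
    ... | no  x≢s  rewrite updateAt-minimal x s {_∖ L t} L x≢s = L! x

    f′≤|L′| : ∀ {x} → T (R x) → updateAt f s (_∸ f t) x ≤ length (L′ x)
    f′≤|L′| {x} Rx with x ≟ s
    ... | yes refl rewrite updateAt-updates s {_∸ f t} f | updateAt-updates s {_∖ L t} L
                         | sym (|L|≡f Rx) | sym (|L|≡f Rt) = length-∖ (L t) (L! s)
    ... | no  x≢s  rewrite updateAt-minimal x s {_∸ f t} f x≢s | updateAt-minimal x s {_∖ L t} L x≢s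
                         = ≤-reflexive (sym (|L|≡f Rx))

    L′⊆L : ∀ {x} → T (R x) → L′ x ⊆ L x
    L′⊆L {x} _ with x ≟ s
    ... | yes refl rewrite updateAt-updates s {_∖ L t} L = proj₁ ∘ ∈-∖⁻ (L s) (L t)
    ... | no  x≢s  rewrite updateAt-minimal x s {_∖ L t} L x≢s = id

    separate : ∃ (IsColouring R (removeEdge s t G) L′) → ∃ (IsColouring R G L)
    separate (φ , col) =
      φ , colouring-⊆ L′⊆L (record { from-lists = from-lists col ; proper = proper′ })
      where
      φs∉Lt : T (R s) → φ s ∉ L t
      φs∉Lt Rs = proj₂ (∈-∖⁻ (L s) (L t) (subst (φ s ∈_) (updateAt-updates s L) (from-lists col Rs)))

      φt∈Lt : φ t ∈ L t
      φt∈Lt = subst (φ t ∈_) (updateAt-minimal t s L (s≢t ∘ sym)) (from-lists col Rt)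

      proper′ : ∀ {x y} → T (R x) → T (R y) → x ≢ y → T (G x y) → φ x ≢ φ y
      proper′ {x} {y} Rx Ry x≢y Gxy with (x ≟ s ×-dec y ≟ t) ⊎-dec (x ≟ t ×-dec y ≟ s)
      ... | yes (inj₁ (refl , refl)) = λ φs≡φt → φs∉Lt Rx (subst (_∈ L t) (sym φs≡φt) φt∈Lt)
      ... | yes (inj₂ (refl , refl)) = λ φt≡φs → φs∉Lt Ry (subst (_∈ L t) φt≡φs φt∈Lt)
      ... | no  ¬st = proper col Rx Ry x≢y (─⁺ (G x) (edge s t x) Gxy (¬st ∘ toWitness))

choosable-pair : ∀ (R : VertexSet n) → T (R u) → T (R v) → T (R w) →
  ¬ T (adjacent G u v) → f w < f u + f v →
  Choosable (R ─ (⁅ u ⁆ ∪ ⁅ v ⁆)) G (lower (adjacent G u ∪ adjacent G v) f) →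
  Choosable (R ─ ⁅ u ⁆) G (lower (adjacent G u ─ ⁅ w ⁆) f) →
  Choosable (R ─ ⁅ v ⁆) G (lower (adjacent G v ─ ⁅ w ⁆) f) →
  Choosable R G f
choosable-pair {u = u} {v = v} {w = w} {G = G} {f = f} R Ru Rv Rw u≁v w<u+v both only-u only-v =
  exactly⇒choosable colour
  where
  colour : ExactlyChoosable R G f
  colour L L! |L|≡f = decide (Any.any? (_∈? L v) (L u))
    where
    f≤|L| : ∀ {x} → T (R x) → f x ≤ length (L x)
    f≤|L| Rx = ≤-reflexive (sym (|L|≡f Rx))

    paint-pair : ∃[ c ] c ∈ L u × c ∈ L v → ∃ (IsColouring R G L)
    paint-pair (c , c∈Lu , c∈Lv) = colour-by-painting R (⁅ u ⁆ ∪ ⁅ v ⁆) (adjacent G u ∪ adjacent G v)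
                                     independent c∈L spared L! f≤|L| both
      where
      in-pair : ∀ x → T ((⁅ u ⁆ ∪ ⁅ v ⁆) x) → x ≡ u ⊎ x ≡ v
      in-pair x = Sum.map toWitness toWitness ∘ Equivalence.to (T-∨ {⁅ u ⁆ x})

      independent : Independent G (⁅ u ⁆ ∪ ⁅ v ⁆)
      independent {x} {y} Xx Xy x≢y Gxy with in-pair x Xx | in-pair y Xy
      ... | inj₁ refl | inj₁ refl = x≢y refl
      ... | inj₁ refl | inj₂ refl = u≁v (adjacent⁺ G Gxy)
      ... | inj₂ refl | inj₁ refl = u≁v (adjacent-sym G (adjacent⁺ G Gxy))
      ... | inj₂ refl | inj₂ refl = x≢y refl

      c∈L : ∀ {x} → T ((⁅ u ⁆ ∪ ⁅ v ⁆) x) → c ∈ L x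
      c∈L {x} Xx with in-pair x Xx
      ... | inj₁ refl = c∈Lu
      ... | inj₂ refl = c∈Lv

      spared : ∀ {x y} → T ((⁅ u ⁆ ∪ ⁅ v ⁆) x) → T ((R ─ (⁅ u ⁆ ∪ ⁅ v ⁆)) y) →
               T (adjacent G x y) → T ((adjacent G u ∪ adjacent G v) y) ⊎ c ∉ L y
      spared {x} Xx _ adj with in-pair x Xx
      ... | inj₁ refl = inj₁ (∪⁺ˡ (adjacent G u) (adjacent G v) adj)
      ... | inj₂ refl = inj₁ (∪⁺ʳ (adjacent G u) (adjacent G v) adj)

    paint-single : ∀ z → c ∈ L z → c ∉ L w →
                   Choosable (R ─ ⁅ z ⁆) G (lower (adjacent G z ─ ⁅ w ⁆) f) → ∃ (IsColouring R G L)
    paint-single {c = c} z c∈Lz c∉Lw =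
      colour-by-painting R ⁅ z ⁆ (adjacent G z ─ ⁅ w ⁆) (⁅⁆-independent G) (⁅⁆-∈ L c∈Lz)
                         spared L! f≤|L|
      where
      spared : ∀ {x y} → T (⁅ z ⁆ x) → T ((R ─ ⁅ z ⁆) y) → T (adjacent G x y) →
               T ((adjacent G z ─ ⁅ w ⁆) y) ⊎ c ∉ L y
      -- decide w ≟ y, not y ≟ w: the latter occurs in the goal, and abstracting it would change it
      spared {y = y} x≡z _ adj with toWitness x≡z | w ≟ y
      ... | refl | yes refl = inj₂ c∉Lw
      ... | refl | no  w≢y  = inj₁ (─⁺ (adjacent G z) ⁅ w ⁆ adj (∉⁅⁆ (w≢y ∘ sym)))

    |Lw|<|Lu++Lv| : length (L w) < length (L u ++ L v)
    |Lw|<|Lu++Lv| = begin-strict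
      length (L w)                ≡⟨ |L|≡f Rw ⟩
      f w                         <⟨ w<u+v ⟩
      f u + f v                   ≡⟨ sym (cong₂ _+_ (|L|≡f Ru) (|L|≡f Rv)) ⟩
      length (L u) + length (L v) ≡⟨ sym (length-++ (L u)) ⟩
      length (L u ++ L v)         ∎
      where open ≤-Reasoning

    decide : Dec (Any (_∈ L v) (L u)) → ∃ (IsColouring R G L)
    decide (yes common) = paint-pair (find common)
    decide (no ¬common) =
      let Lu++Lv! = Unique.++⁺ (L! u) (L! v) (λ (c∈Lu , c∈Lv) → ¬common (lose c∈Lu c∈Lv))
          c , c∈Lu++Lv , c∉Lw = ∃-fresh Lu++Lv! |Lw|<|Lu++Lv|
      in [ (λ c∈Lu → paint-single u c∈Lu c∉Lw only-u) , (λ c∈Lv → paint-single v c∈Lv c∉Lw only-v) ]′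
           (∈-++⁻ (L u) c∈Lu++Lv)

-- Certificates

infixr 5 _▷_

-- v ▷ C : colour v last, after colouring the remaining vertices according to C.
data Certificate {n} : VertexSet n → Graph n → (Fin n → ℕ) → Set where
  empty : ∀ {R G f} {R-empty : True (all? λ x → ¬? (T? (R x)))} → Certificate R G f
  _▷_   : ∀ {R G f} v {Rv : T (R v)} {deg<f : True (degree R G v <? f v)} →
          Certificate (R ─ ⁅ v ⁆) G f → Certificate R G f
  split : ∀ {R G f} s t {s≢t : False (s ≟ t)} {Rt : T (R t)} →
          Certificate R (removeEdge s t G) (updateAt f s (_∸ f t)) → Certificate R G f
  pair  : ∀ {R G f} u v w {Ru : T (R u)} {Rv : T (R v)} {Rw : T (R w)}
          {u≁v : False (T? (adjacent G u v))} {w<u+v : True (f w <? f u + f v)} →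
          Certificate (R ─ (⁅ u ⁆ ∪ ⁅ v ⁆)) G (lower (adjacent G u ∪ adjacent G v) f) →
          Certificate (R ─ ⁅ u ⁆) G (lower (adjacent G u ─ ⁅ w ⁆) f) →
          Certificate (R ─ ⁅ v ⁆) G (lower (adjacent G v ─ ⁅ w ⁆) f) →
          Certificate R G f

choosable : Certificate R G f → Choosable R G f
choosable (empty {R-empty = R-empty}) = choosable-∅ (toWitness R-empty)
choosable (_▷_ {R} v {Rv} {deg<f} cert) = choosable-greedy R Rv (toWitness deg<f) (choosable cert)
choosable (split {R} s t {s≢t} {Rt} cert) = choosable-split R (toWitnessFalse s≢t) Rt (choosable cert)
choosable (pair {R} u v w {Ru} {Rv} {Rw} {u≁v} {w<u+v} both only-u only-v) =
  choosable-pair R Ru Rv Rw (toWitnessFalse u≁v) (toWitness w<u+v)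
    (choosable both) (choosable only-u) (choosable only-v)

adjacent? : ∀ (E : Edges n) x y → Dec (Adj E x y)
adjacent? E x y = Any.any? (≡-dec _≟_ _≟_ (x , y)) E ⊎-dec Any.any? (≡-dec _≟_ _≟_ (y , x)) E

dist≤2? : ∀ (E : Edges n) x y → Dec (Dist≤2 E x y)
dist≤2? E x y = adjacent? E x y ⊎-dec any? (λ z → adjacent? E x z ×-dec adjacent? E z y)

square : Edges n → Graph n
square E x y = isYes (dist≤2? E x y)

every : VertexSet n
every _ = true

good : ∀ (E : Edges n) (ℓ : Vec ℕ n) → Certificate every (square E) (lookup ℓ) → Good E ℓ
good E ℓ cert L L! ℓ≤|L| =
  let φ , col = choosable cert L L! (λ {x} _ → ℓ≤|L| x)
  in φ , (λ _ → from-lists col tt) , (λ _ _ x≢y d → proper col tt tt x≢y (fromWitness d))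

certificate₁ : Certificate every (square E1) (lookup ℓ1)
certificate₁ =
  pair (# 0) (# 3) (# 2)
    (# 2 ▷ # 1 ▷ empty)
    (# 2 ▷ # 3 ▷ # 1 ▷ empty)
    (# 2 ▷ # 0 ▷ # 1 ▷ empty)

certificate₂ : Certificate every (square E2) (lookup ℓ2)
certificate₂ =
  split (# 2) (# 4) (# 4 ▷ # 3 ▷ # 5 ▷ # 0 ▷ # 1 ▷ # 6 ▷ # 2 ▷ empty)

certificate₃ : Certificate every (square E3) (lookup ℓ3)
certificate₃ =
  pair (# 2) (# 8) (# 6)
    (# 6 ▷ # 5 ▷ # 3 ▷ # 0 ▷ # 1 ▷ # 4 ▷ # 7 ▷ empty)
    (# 6 ▷ # 7 ▷ # 5 ▷ # 3 ▷ # 0 ▷ # 1 ▷ # 4 ▷ # 8 ▷ empty)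
    (# 6 ▷ # 7 ▷ # 5 ▷ # 3 ▷ # 0 ▷ # 1 ▷ # 2 ▷ # 4 ▷ empty)

certificate₄ : Certificate every (square E4) (lookup ℓ4)
certificate₄ =
  split (# 4) (# 9)
    (# 9 ▷ split (# 2) (# 4)
      (pair (# 2) (# 8) (# 6)
        (# 6 ▷ # 5 ▷ # 3 ▷ # 0 ▷ # 1 ▷ # 7 ▷ # 10 ▷ # 4 ▷ empty)
        (# 6 ▷ # 7 ▷ # 5 ▷ # 3 ▷ # 0 ▷ # 1 ▷ # 8 ▷ # 10 ▷ # 4 ▷ empty)
        (# 6 ▷ # 7 ▷ # 5 ▷ # 3 ▷ # 0 ▷ # 1 ▷ # 2 ▷ # 10 ▷ # 4 ▷ empty)))

certificate₅ : Certificate every (square E5) (lookup ℓ5)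
certificate₅ =
  split (# 2) (# 4) (# 4 ▷ # 3 ▷ # 5 ▷ # 1 ▷ # 0 ▷ # 6 ▷ # 2 ▷ empty)

certificate₆ : Certificate every (square E6) (lookup ℓ6)
certificate₆ =
  pair (# 2) (# 8) (# 6)
    (# 6 ▷ # 5 ▷ # 3 ▷ # 1 ▷ # 0 ▷ # 4 ▷ # 7 ▷ empty)
    (# 6 ▷ # 7 ▷ # 5 ▷ # 3 ▷ # 1 ▷ # 0 ▷ # 4 ▷ # 8 ▷ empty)
    (# 6 ▷ # 7 ▷ # 5 ▷ # 3 ▷ # 1 ▷ # 0 ▷ # 2 ▷ # 4 ▷ empty)

certificate₇ : Certificate every (square E7) (lookup ℓ7)
certificate₇ =
  split (# 4) (# 10)
    (pair (# 4) (# 10) (# 9)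
      (# 9 ▷ # 3 ▷ split (# 6) (# 7) (# 7 ▷ # 5 ▷ # 1 ▷ # 0 ▷ # 2 ▷ # 8 ▷ # 6 ▷ empty))
      (# 9 ▷ # 10 ▷ # 3 ▷ split (# 6) (# 7) (# 7 ▷ # 5 ▷ # 1 ▷ # 0 ▷ # 2 ▷ # 8 ▷ # 6 ▷ empty))
      (# 9 ▷ pair (# 2) (# 8) (# 6)
        (# 6 ▷ # 5 ▷ # 3 ▷ # 1 ▷ # 0 ▷ # 4 ▷ # 7 ▷ empty)
        (# 6 ▷ # 7 ▷ # 5 ▷ # 3 ▷ # 1 ▷ # 0 ▷ # 4 ▷ # 8 ▷ empty)
        (# 6 ▷ # 7 ▷ # 5 ▷ # 3 ▷ # 1 ▷ # 0 ▷ # 2 ▷ # 4 ▷ empty)))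

certificate₈ : Certificate every (square E8) (lookup ℓ8)
certificate₈ =
  split (# 3) (# 5) (# 5 ▷ # 4 ▷ # 6 ▷ # 2 ▷ # 0 ▷ # 1 ▷ # 7 ▷ # 3 ▷ empty)

certificate₉ : Certificate every (square E9) (lookup ℓ9)
certificate₉ =
  pair (# 3) (# 9) (# 7)
    (# 7 ▷ # 6 ▷ # 4 ▷ # 2 ▷ # 0 ▷ # 1 ▷ # 5 ▷ # 8 ▷ empty)
    (# 7 ▷ # 8 ▷ # 6 ▷ # 4 ▷ # 2 ▷ # 0 ▷ # 1 ▷ # 5 ▷ # 9 ▷ empty)
    (# 7 ▷ # 8 ▷ # 6 ▷ # 4 ▷ # 2 ▷ # 0 ▷ # 1 ▷ # 3 ▷ # 5 ▷ empty)

certificate₁₀ : Certificate every (square E10) (lookup ℓ10)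
certificate₁₀ =
  split (# 5) (# 11)
    (pair (# 5) (# 11) (# 10)
      (# 10 ▷ # 4 ▷ split (# 7) (# 8) (# 8 ▷ # 6 ▷ # 2 ▷ # 0 ▷ # 1 ▷ # 3 ▷ # 9 ▷ # 7 ▷ empty))
      (# 10 ▷ # 11 ▷ # 4 ▷ split (# 7) (# 8) (# 8 ▷ # 6 ▷ # 2 ▷ # 0 ▷ # 1 ▷ # 3 ▷ # 9 ▷ # 7 ▷ empty))
      (# 10 ▷ pair (# 3) (# 9) (# 7)
        (# 7 ▷ # 6 ▷ # 4 ▷ # 2 ▷ # 0 ▷ # 1 ▷ # 5 ▷ # 8 ▷ empty)
        (# 7 ▷ # 8 ▷ # 6 ▷ # 4 ▷ # 2 ▷ # 0 ▷ # 1 ▷ # 5 ▷ # 9 ▷ empty)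
        (# 7 ▷ # 8 ▷ # 6 ▷ # 4 ▷ # 2 ▷ # 0 ▷ # 1 ▷ # 3 ▷ # 5 ▷ empty)))
lemma9 : Good E1 ℓ1 × Good E2 ℓ2 × Good E3 ℓ3 × Good E4 ℓ4 × Good E5 ℓ5
    × Good E6 ℓ6 × Good E7 ℓ7 × Good E8 ℓ8 × Good E9 ℓ9 × Good E10 ℓ10
lemma9 = good E1 ℓ1 certificate₁ , good E2 ℓ2 certificate₂ , good E3 ℓ3 certificate₃
       , good E4 ℓ4 certificate₄ , good E5 ℓ5 certificate₅ , good E6 ℓ6 certificate₆
       , good E7 ℓ7 certificate₇ , good E8 ℓ8 certificate₈ , good E9 ℓ9 certificate₉
       , good E10 ℓ10 certificate₁₀
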